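{- Let $\mathcal{C}\subseteq\mathbb{F}^I$ be a linear code and $(\mathcal{G},\omega)$ a graph decomposition of $\mathcal{C}$, with $\mathcal{G}=(V,E)$ connected. For a vertex cut $W$ of $\mathcal{G}$, let $\mathcal{G}_1,\ldots,\mathcal{G}_\delta$ be the components of $\mathcal{G}-W$, and define $\lambda(W)=\dim(\mathcal{C})-\sum_{i=1}^{\delta}\dim(\mathcal{C}_{J_i})$ where $J_i=\omega^{ -1}(V(\mathcal{G}_i))$. Then for any graphical realization $\Gamma=(\mathcal{G},\omega,(\mathcal{S}_e)_{e\in E},(C_v)_{v\in V})$ of $\mathcal{C}$ extending $(\mathcal{G},\omega)$, we have $\sum_{v\in W}\dim(C_v)\ge\lambda(W)$.
   Context: $\mathbb{F}$ is a finite field and $I$ a finite index set; a linear code on $I$ is a subspace $\mathcal{C}\subseteq\mathbb{F}^I$. For $J\subseteq I$, $\mathcal{C}_J=\{\mathbf{c}|_J:\mathbf{c}\in\mathcal{C},\ \mathbf{c}|_{I\setminus J}=\mathbf{0}\}$ where $\mathbf{c}|_J=(c_i)_{i\in J}$. Graphs are finite. A graph decomposition of $\mathcal{C}$ is a pair $(\mathcal{G},\omega)$ with $\mathcal{G}=(V,E)$ a connected graph and $\omega:I\to V$ any map. $\mathcal{G}-W$ is the graph obtained by deleting the vertices of $W$ and all incident edges; $W\subseteq V$ is a vertex cut if $\mathcal{G}-W$ is disconnected. $E(v)$ denotes the set of edges incident with $v$. A graphical model is a tuple $(\mathcal{G},\omega,(\mathcal{S}_e)_{e\in E},(C_v)_{v\in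 V})$ where each $\mathcal{S}_e$ is a finite-dimensional $\mathbb{F}$-vector space and each $C_v$ is a subspace of $\mathbb{F}^{\omega^{ -1}(v)}\oplus\bigoplus_{e\in E(v)}\mathcal{S}_e$. Its full behavior $\mathfrak{B}$ is the set of all $\mathbf{b}=((x_i)_{i\in I},(\mathbf{s}_e)_{e\in E})$ such that for every $v$, $\mathbf{b}|_v:=((x_i)_{i\in\omega^{ -1}(v)},(\mathbf{s}_e)_{e\in E(v)})\in C_v$. The model is essential if $\{\mathbf{b}|_v:\mathbf{b}\in\mathfrak{B}\}=C_v$ for all $v$ and $\{\mathbf{s}_e:\mathbf{b}\in\mathfrak{B}\}=\mathcal{S}_e$ for all $e$. A graphical realization of $\mathcal{C}$ extending $(\mathcal{G},\omega)$ is an essential graphical model with $\{(x_i)_{i\in I}:\mathbf{b}\in\mathfrak{B}\}=\mathcal{C}$. -}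

module Defs where

open import Level using (Level; 0ℓ; suc)
open import Data.Nat as ℕ using (ℕ; zero)
open import Data.Fin using (Fin)
import Data.Fin as Fin
open import Data.Bool using (Bool; true; false; if_then_else_)
open import Data.Maybe using (Maybe; just; nothing)
open import Data.Product using (Σ; ∃; ∃-syntax; _×_; _,_)
open import Data.Sum using (_⊎_; inj₁; inj₂)
open import Data.List using (List; map; allFin)
open import Data.Nat.ListAction using (sum)
open import Data.Integer as ℤ using (ℤ; +_)
open import Relation.Nullary using (¬_)
open import Relation.Binary.PropositionalEquality using (_≡_; _≢_)
open import Function.Bundles using (_↔_)
open import Algebra.Structures using (IsCommutativeRing)

record FiniteField : Set₁ where
  infixl 6 _+_
  infixl 7 _*_
  field
    Carrier : Set
    _+_ _*_ : Carrier → Carrier → Carrier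
    -_      : Carrier → Carrier
    0# 1#   : Carrier
    isCommutativeRing : IsCommutativeRing _≡_ _+_ _*_ -_ 0# 1#
    0≢1     : 0# ≢ 1#
    inverse : ∀ x → x ≢ 0# → ∃[ y ] (x * y ≡ 1#)
    size    : ℕ
    finite  : Carrier ↔ Fin size

module LinAlg (𝔽 : FiniteField) where
  open FiniteField 𝔽 renaming (Carrier to F)

  Vect : Set → Set
  Vect A = A → F

  _≈ᵥ_ : {A : Set} → Vect A → Vect A → Set
  x ≈ᵥ y = ∀ a → x a ≡ y a

  zeroᵥ : {A : Set} → Vect A
  zeroᵥ _ = 0#

  _+ᵥ_ : {A : Set} → Vect A → Vect A → Vect A
  (x +ᵥ y) a = x a + y a

  _·ᵥ_ : {A : Set} → F → Vect A → Vect A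
  (c ·ᵥ x) a = c * x a

  sumF : (d : ℕ) → (Fin d → F) → F
  sumF zero    f = 0#
  sumF (ℕ.suc d) f = f Fin.zero + sumF d (λ j → f (Fin.suc j))

  lincomb : {A : Set} (d : ℕ) → (Fin d → F) → (Fin d → Vect A) → Vect A
  lincomb d c v a = sumF d (λ j → c j * v j a)

  Subspace : Set → Set₁
  Subspace A = Vect A → Set

  record IsSubspace {A : Set} (P : Subspace A) : Set where
    field
      resp  : ∀ {x y} → x ≈ᵥ y → P x → P y
      zero∈ : P zeroᵥ
      +∈    : ∀ {x y} → P x → P y → P (x +ᵥ y)
      ·∈    : ∀ c {x} → P x → P (c ·ᵥ x)

  record HasDim {A : Set} (P : Subspace A) (d : ℕ) : Set where
    field
      basis       : Fin d → Vect A
      basis∈      : ∀ j → P (basis j)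
      independent : ∀ c → lincomb d c basis ≈ᵥ zeroᵥ → ∀ j → c j ≡ 0#
      spanning    : ∀ x → P x → ∃[ c ] (x ≈ᵥ lincomb d c basis)

  Sub : {n : ℕ} → (Fin n → Set) → Set
  Sub {n} J = Σ (Fin n) J

  -- C_J = { c|_J : c ∈ C, c|_{I∖J} = 0 }
  shortened : {n : ℕ} → Subspace (Fin n) → (J : Fin n → Set) → Subspace (Sub J)
  shortened C J y =
    ∃[ c ] (C c × (∀ i → ¬ J i → c i ≡ 0#) × (∀ (p : Sub J) → c (Data.Product.proj₁ p) ≡ y p))

record Graph (m : ℕ) : Set where
  field
    k      : ℕ
    src tgt : Fin k → Fin m
    noLoop : ∀ e → src e ≢ tgt e
    simple : ∀ e e' → ((src e ≡ src e' × tgt e ≡ tgt e') ⊎ (src e ≡ tgt e' × tgt e ≡ src e'))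
                    → e ≡ e'

module _ {m : ℕ} (G : Graph m) where
  open Graph G

  Incident : Fin k → Fin m → Set
  Incident e v = (src e ≡ v) ⊎ (tgt e ≡ v)

  Joins : Fin k → Fin m → Fin m → Set
  Joins e u w = (src e ≡ u × tgt e ≡ w) ⊎ (src e ≡ w × tgt e ≡ u)

  -- Reach W u v : there is a path from u to v in G - W  (W ⊆ V given by a Boolean mask)
  data Reach (W : Fin m → Bool) : Fin m → Fin m → Set where
    here : ∀ {u} → W u ≡ false → Reach W u u
    step : ∀ {u w v} (e : Fin k) → W u ≡ false → Joins e u w → Reach W w v → Reach W u v

  Connected : Set
  Connected = ∀ u v → Reach (λ _ → false) u v

  VertexCut : (Fin m → Bool) → Set
  VertexCut W = ∃[ u ] ∃[ v ] (W u ≡ false × W v ≡ false × ¬ Reach W u v)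

  -- κ labels the δ connected components G₁,…,G_δ of G - W:
  -- κ v = nothing for v ∈ W, and κ v = just j when v ∈ V(G_{j})
  record Components (W : Fin m → Bool) (δ : ℕ) (κ : Fin m → Maybe (Fin δ)) : Set where
    field
      inW    : ∀ v → W v ≡ true → κ v ≡ nothing
      notInW : ∀ v → W v ≡ false → ∃[ j ] (κ v ≡ just j)
      sameComponent : ∀ u v → W u ≡ false → W v ≡ false → (κ u ≡ κ v → Reach W u v)
      reachSame     : ∀ u v → Reach W u v → κ u ≡ κ v
      nonempty      : ∀ j → ∃[ v ] (κ v ≡ just j)

module Models (𝔽 : FiniteField) where
  open FiniteField 𝔽 renaming (Carrier to F)
  open LinAlg 𝔽 public

  record GraphicalModel {n m : ℕ} (G : Graph m) (ω : Fin n → Fin m) : Set₁ where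
    open Graph G public
    field
      -- S_e = F^{stateDim e}  (finite-dimensional F-vector spaces)
      stateDim : Fin k → ℕ
    -- coordinates of F^{ω⁻¹(v)} ⊕ ⊕_{e ∈ E(v)} S_e
    Local : Fin m → Set
    Local v = (Σ (Fin n) λ i → ω i ≡ v) ⊎ (Σ (Fin k) λ e → Incident G e v × Fin (stateDim e))
    field
      Cv : (v : Fin m) → Subspace (Local v)
      Cv-subspace : ∀ v → IsSubspace (Cv v)

    Config : Set
    Config = (Fin n → F) × ((e : Fin k) → Fin (stateDim e) → F)

    symbols : Config → Fin n → F
    symbols (x , s) = x

    states : Config → (e : Fin k) → Fin (stateDim e) → F
    states (x , s) = s

    local : Config → (v : Fin m) → Vect (Local v)
    local (x , s) v (inj₁ (i , _)) = x i
    local (x , s) v (inj₂ (e , _ , t)) = s e t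

    InBehavior : Config → Set
    InBehavior b = ∀ v → Cv v (local b v)

    Essential : Set
    Essential =
      (∀ v y → Cv v y → ∃[ b ] (InBehavior b × local b v ≈ᵥ y)) ×
      (∀ e (σ : Fin (stateDim e) → F) → ∃[ b ] (InBehavior b × states b e ≈ᵥ σ))

    Realizes : Subspace (Fin n) → Set
    Realizes C = ∀ x → (C x → ∃[ b ] (InBehavior b × symbols b ≈ᵥ x))
                     × (∀ b → InBehavior b → symbols b ≈ᵥ x → C x)

  IsRealization : {n m : ℕ} {G : Graph m} {ω : Fin n → Fin m}
                → Subspace (Fin n) → GraphicalModel G ω → Set
  IsRealization C Γ = GraphicalModel.Essential Γ × GraphicalModel.Realizes Γ C

sumOver : {m : ℕ} → (Fin m → Bool) → (Fin m → ℕ) → ℕ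
sumOver {m} W f = sum (map (λ v → if W v then f v else 0) (allFin m))

sumFin : (δ : ℕ) → (Fin δ → ℕ) → ℕ
sumFin δ f = sum (map f (allFin δ))

module Submission where

-- Lift a basis c₁ … c_d of C to behaviours b₁ … b_d.  The coordinates
-- of the local configurations b_k|_v (v ∈ W) in bases of the C_v give
-- q = Σ_{v ∈ W} dim C_v linear forms on the coefficient space F^d.  For a in
-- their common kernel, b = Σ a_k b_k is a behaviour vanishing on W; cutting
-- it along W splits it into behaviours living on single components, so
-- Σ a_k c_k lies in C_{J₁} + … + C_{J_δ}, a space spanned by
-- N = Σⱼ dim C_{Jⱼ} vectors.  A rank bound (Gaussian elimination on the q
-- forms, with the Steinitz exchange lemma as base case) gives d ≤ q + N.

open import Defs
open import Level using (0ℓ)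
open import Function using (_∘_; case_of_)
open import Data.Empty using (⊥-elim)
open import Data.Bool using (Bool; true; false; if_then_else_)
open import Data.Bool.Properties using (if-float)
open import Data.Maybe using (Maybe; just; nothing)
import Data.Maybe.Properties as Maybe
open import Data.Product using (∃-syntax; _×_; _,_; proj₁; proj₂)
open import Data.Sum using (_⊎_; inj₁; inj₂)
open import Data.Nat as ℕ using (ℕ; zero; suc; z≤n; s≤s; _∸_)
import Data.Nat.Properties as ℕ
open import Data.Fin as Fin using (Fin; punchIn)
import Data.Fin.Properties as Fin
open import Data.List as List using (List; []; _∷_; length; map; tabulate; concatMap; allFin)
open import Data.Nat.ListAction using () renaming (sum to sumℕ)
open import Data.List.Membership.Propositional using (_∈_)
open import Data.List.Membership.Propositional.Properties using (∈-concat⁺′; ∈-tabulate⁺; ∈-map⁺; ∈-allFin)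
import Data.List.Relation.Unary.Any as Any
open import Data.List.Relation.Unary.Any.Properties using (lookup-index)
open import Data.List.Properties using (length-map; length-tabulate; length-++; map-cong)
open import Data.List.Relation.Unary.All as All using (All; []; _∷_)
import Data.List.Relation.Unary.All.Properties as All
open import Data.Vec.Functional using (insertAt)
open import Data.Vec.Functional.Properties using (insertAt-lookup; insertAt-punchIn)
open import Relation.Nullary using (¬_; Dec; yes; no)
open import Relation.Nullary.Decidable using (via-injection)
open import Relation.Binary.Definitions using (DecidableEquality)
open import Relation.Binary.PropositionalEquality
open import Algebra.Bundles using (CommutativeRing)
open import Function.Properties.Inverse using (↔⇒↣)

length-concatMap : {A B : Set} (f : A → List B) (xs : List A) →
                   length (concatMap f xs) ≡ sumℕ (map (length ∘ f) xs)
length-concatMap f []       = refl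
length-concatMap f (x ∷ xs) = trans (length-++ (f x)) (cong (length (f x) ℕ.+_) (length-concatMap f xs))

module LinearAlgebra (𝔽 : FiniteField) where
  open FiniteField 𝔽 renaming (Carrier to F)
  open LinAlg 𝔽 public

  fieldRing : CommutativeRing 0ℓ 0ℓ
  fieldRing = record { isCommutativeRing = isCommutativeRing }

  open CommutativeRing fieldRing
    using (ring; semiring; +-comm; +-identityʳ; *-assoc; *-comm; *-identityˡ; distribˡ; distribʳ;
           zeroˡ; zeroʳ; -‿inverseʳ)
  open import Algebra.Properties.Ring ring using (-‿distribˡ-*; -‿distribʳ-*)
  open import Algebra.Properties.Semiring.Sum semiring
    using (sum-cong-≗; sum-replicate-zero; sum-remove; ∑-distrib-+; ∑-comm; *-distribˡ-sum; *-distribʳ-sum)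
  open import Algebra.Properties.Semiring.Sum semiring public using (sum; sum-syntax)
  open ≡-Reasoning

  neg-swap : ∀ x y → x * - y ≡ - x * y
  neg-swap x y = trans (sym (-‿distribʳ-* x y)) (-‿distribˡ-* x y)

  _≟F_ : DecidableEquality F
  _≟F_ = via-injection (↔⇒↣ finite) Fin._≟_

  sum-zero : ∀ {p} {f : Fin p → F} → (∀ i → f i ≡ 0#) → sum f ≡ 0#
  sum-zero {p} f≗0 = trans (sum-cong-≗ f≗0) (sum-replicate-zero p)

  sum-single : ∀ {p} (r : Fin p) (f : Fin p → F) → (∀ k → k ≢ r → f k ≡ 0#) → sum f ≡ f r
  sum-single {suc p} r f off = begin
    sum f                          ≡⟨ sum-remove {i = r} f ⟩
    f r + sum (f ∘ punchIn r)      ≡⟨ cong (f r +_) (sum-zero (λ j → off _ (Fin.punchInᵢ≢i r j))) ⟩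
    f r + 0#                       ≡⟨ +-identityʳ (f r) ⟩
    f r                            ∎

  sumF≡sum : ∀ d (f : Fin d → F) → sumF d f ≡ sum f
  sumF≡sum zero    f = refl
  sumF≡sum (suc d) f = cong (f Fin.zero +_) (sumF≡sum d (f ∘ Fin.suc))

  lc : {A : Set} {p : ℕ} → (Fin p → F) → (Fin p → Vect A) → Vect A
  lc {p = p} a u x = ∑[ i < p ] (a i * u i x)

  lincomb≗lc : {A : Set} {p : ℕ} (a : Fin p → F) (u : Fin p → Vect A) → lincomb p a u ≈ᵥ lc a u
  lincomb≗lc {p = p} a u x = sumF≡sum p (λ i → a i * u i x)

  infix 7 _·_
  _·_ : {p : ℕ} → (Fin p → F) → (Fin p → F) → F
  _·_ {p} a r = ∑[ i < p ] (a i * r i)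

  Orthogonal : {p : ℕ} → (Fin p → F) → List (Fin p → F) → Set
  Orthogonal a rows = All (λ r → a · r ≡ 0#) rows

  Independent : {A : Set} {p : ℕ} → (Fin p → Vect A) → Set
  Independent {p = p} u = ∀ (a : Fin p → F) → lc a u ≈ᵥ zeroᵥ → ∀ i → a i ≡ 0#

  Span : {A : Set} {N : ℕ} → (Fin N → Vect A) → Subspace A
  Span {N = N} w x = ∃[ e ] (x ≈ᵥ lc e w)

  lc-congʳ : {A : Set} {p : ℕ} (a : Fin p → F) {u v : Fin p → Vect A} →
             (∀ i → u i ≈ᵥ v i) → lc a u ≈ᵥ lc a v
  lc-congʳ {p = p} a u≈v x = sum-cong-≗ {p} (λ i → cong (a i *_) (u≈v i x))

  lc-zero : {A : Set} {p : ℕ} {a : Fin p → F} (u : Fin p → Vect A) → (∀ i → a i ≡ 0#) → lc a u ≈ᵥ zeroᵥ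
  lc-zero u a≡0 x = sum-zero (λ i → trans (cong (_* u i x) (a≡0 i)) (zeroˡ _))

  lc-lc : {A : Set} {p N : ℕ} (a : Fin p → F) (M : Fin p → Fin N → F) (w : Fin N → Vect A) →
          lc a (λ i → lc (M i) w) ≈ᵥ lc (λ l → ∑[ i < p ] (a i * M i l)) w
  lc-lc {p = p} {N} a M w x = begin
    ∑[ i < p ] (a i * ∑[ l < N ] (M i l * w l x))
      ≡⟨ sum-cong-≗ (λ i → *-distribˡ-sum (a i) (λ l → M i l * w l x)) ⟩
    ∑[ i < p ] ∑[ l < N ] (a i * (M i l * w l x))
      ≡⟨ ∑-comm (λ i l → a i * (M i l * w l x)) ⟩
    ∑[ l < N ] ∑[ i < p ] (a i * (M i l * w l x))
      ≡⟨ sum-cong-≗ (λ l → sum-cong-≗ (λ i → sym (*-assoc (a i) (M i l) (w l x)))) ⟩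
    ∑[ l < N ] ∑[ i < p ] (a i * M i l * w l x)
      ≡⟨ sum-cong-≗ (λ l → sym (*-distribʳ-sum (w l x) (λ i → a i * M i l))) ⟩
    ∑[ l < N ] (∑[ i < p ] (a i * M i l) * w l x) ∎

  lc-closed : {A : Set} {P : Subspace A} → IsSubspace P →
              ∀ {p} (a : Fin p → F) (u : Fin p → Vect A) → (∀ i → P (u i)) → P (lc a u)
  lc-closed P-sub {zero}  a u u∈P = IsSubspace.resp P-sub (λ _ → refl) (IsSubspace.zero∈ P-sub)
  lc-closed P-sub {suc p} a u u∈P =
    IsSubspace.resp P-sub (λ _ → refl)
      (IsSubspace.+∈ P-sub (IsSubspace.·∈ P-sub (a Fin.zero) (u∈P Fin.zero))
                           (lc-closed P-sub (a ∘ Fin.suc) (u ∘ Fin.suc) (u∈P ∘ Fin.suc)))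

  span-subspace : {A : Set} {N : ℕ} (w : Fin N → Vect A) → IsSubspace (Span w)
  span-subspace {N = N} w = record
    { resp  = λ { x≈y (e , x≈e) → e , λ a → trans (sym (x≈y a)) (x≈e a) }
    ; zero∈ = (λ _ → 0#) , λ a → sym (lc-zero w (λ _ → refl) a)
    ; +∈    = λ { (e , x≈e) (e′ , y≈e′) → (λ l → e l + e′ l) , λ a → begin
                 _ + _                                    ≡⟨ cong₂ _+_ (x≈e a) (y≈e′ a) ⟩
                 lc e w a + lc e′ w a
                   ≡⟨ sym (∑-distrib-+ (λ l → e l * w l a) (λ l → e′ l * w l a)) ⟩
                 ∑[ l < N ] (e l * w l a + e′ l * w l a)
                   ≡⟨ sum-cong-≗ (λ l → sym (distribʳ (w l a) (e l) (e′ l))) ⟩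
                 lc (λ l → e l + e′ l) w a                ∎ }
    ; ·∈    = λ { c (e , x≈e) → (λ l → c * e l) , λ a → begin
                 c * _                                       ≡⟨ cong (c *_) (x≈e a) ⟩
                 c * lc e w a                                ≡⟨ *-distribˡ-sum c (λ l → e l * w l a) ⟩
                 ∑[ l < N ] (c * (e l * w l a))              ≡⟨ sum-cong-≗ (λ l → sym (*-assoc c (e l) (w l a))) ⟩
                 lc (λ l → c * e l) w a                      ∎ }
    }

  sum-closed : {A : Set} {P : Subspace A} → IsSubspace P →
               ∀ {d} (f : Fin d → Vect A) → (∀ j → P (f j)) → P (λ x → ∑[ j < d ] f j x)
  sum-closed P-sub {d} f f∈P =
    IsSubspace.resp P-sub (λ x → sum-cong-≗ {d} (λ j → *-identityˡ (f j x))) (lc-closed P-sub (λ _ → 1#) f f∈P)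

  span-mono : {A : Set} {N d : ℕ} {w : Fin N → Vect A} {z : Fin d → Vect A} →
              (∀ s → Span w (z s)) → ∀ {x} → Span z x → Span w x
  span-mono {w = w} {z} z∈w (e , x≈ez) =
    IsSubspace.resp (span-subspace w) (λ a → sym (x≈ez a)) (lc-closed (span-subspace w) e z z∈w)

  unit : {p : ℕ} → Fin p → Fin p → F
  unit i k with k Fin.≟ i
  ... | yes _ = 1#
  ... | no  _ = 0#

  unit-diag : {p : ℕ} (i : Fin p) → unit i i ≡ 1#
  unit-diag i with i Fin.≟ i
  ... | yes _  = refl
  ... | no i≢i = ⊥-elim (i≢i refl)

  unit-off : {p : ℕ} (i k : Fin p) → k ≢ i → unit i k ≡ 0#
  unit-off i k k≢i with k Fin.≟ i
  ... | yes k≡i = ⊥-elim (k≢i k≡i)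
  ... | no  _   = refl

  lc-unit : {A : Set} {p : ℕ} (i : Fin p) (u : Fin p → Vect A) → lc (unit i) u ≈ᵥ u i
  lc-unit i u x = begin
    lc (unit i) u x     ≡⟨ sum-single i _ (λ k k≢i → trans (cong (_* u k x) (unit-off i k k≢i)) (zeroˡ _)) ⟩
    unit i i * u i x    ≡⟨ cong (_* u i x) (unit-diag i) ⟩
    1# * u i x          ≡⟨ *-identityˡ _ ⟩
    u i x               ∎

  member-in-span : {A : Set} {ws : List (Vect A)} {x : Vect A} → x ∈ ws → Span (List.lookup ws) x
  member-in-span {ws = ws} x∈ws =
    unit (Any.index x∈ws) , λ a → sym (trans (lc-unit (Any.index x∈ws) (List.lookup ws) a)
                                             (sym (cong-app (lookup-index x∈ws) a)))

  zero-or-pivot : ∀ {p} (r : Fin p → F) → (∀ i → r i ≡ 0#) ⊎ ∃[ i ] (r i ≢ 0#)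
  zero-or-pivot {p} r with Fin.all? (λ i → r i ≟F 0#)
  ... | yes r≡0 = inj₁ r≡0
  ... | no  r≢0 = inj₂ (Fin.¬∀⟶∃¬ p _ (λ i → r i ≟F 0#) r≢0)

  -- One step of Gaussian elimination, pivoting a row r of F^{p+1} at a
  -- coordinate i₀ with r i₀ ≠ 0.  Coefficient vectors a on the p remaining
  -- coordinates extend uniquely to vectors orthogonal to r, and `reduce`
  -- is the transpose of this extension.
  module Pivot {p : ℕ} (r : Fin (suc p) → F) (i₀ : Fin (suc p)) (r≢0 : r i₀ ≢ 0#) where

    r⁻¹ : F
    r⁻¹ = proj₁ (inverse (r i₀) r≢0)

    r⁻¹-inverse : r i₀ * r⁻¹ ≡ 1#
    r⁻¹-inverse = proj₂ (inverse (r i₀) r≢0)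

    -- the multiple of the pivot coordinate to subtract from coordinate j
    c : Fin p → F
    c j = r (punchIn i₀ j) * r⁻¹

    reduce : (Fin (suc p) → F) → Fin p → F
    reduce X j = X (punchIn i₀ j) + (- c j) * X i₀

    extend : (Fin p → F) → Fin (suc p) → F
    extend a = insertAt a i₀ (- (a · c))

    extend-· : ∀ (a : Fin p → F) (X : Fin (suc p) → F) → extend a · X ≡ a · reduce X
    extend-· a X = begin
      extend a · X
        ≡⟨ sum-remove {i = i₀} (λ i → extend a i * X i) ⟩
      extend a i₀ * X i₀ + ∑[ j < p ] (extend a (punchIn i₀ j) * X (punchIn i₀ j))
        ≡⟨ cong₂ _+_ (cong (_* X i₀) (insertAt-lookup a i₀ _))
                     (sum-cong-≗ (λ j → cong (_* X (punchIn i₀ j)) (insertAt-punchIn a i₀ _ j))) ⟩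
      - (a · c) * X i₀ + ∑[ j < p ] (a j * X (punchIn i₀ j))
        ≡⟨ +-comm _ _ ⟩
      ∑[ j < p ] (a j * X (punchIn i₀ j)) + - (a · c) * X i₀
        ≡⟨ cong (∑[ j < p ] (a j * X (punchIn i₀ j)) +_) pivot-term ⟩
      ∑[ j < p ] (a j * X (punchIn i₀ j)) + ∑[ j < p ] (a j * ((- c j) * X i₀))
        ≡⟨ sym (∑-distrib-+ (λ j → a j * X (punchIn i₀ j)) (λ j → a j * ((- c j) * X i₀))) ⟩
      ∑[ j < p ] (a j * X (punchIn i₀ j) + a j * ((- c j) * X i₀))
        ≡⟨ sum-cong-≗ (λ j → sym (distribˡ (a j) _ _)) ⟩
      a · reduce X ∎
      where
        pivot-term : - (a · c) * X i₀ ≡ ∑[ j < p ] (a j * ((- c j) * X i₀))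
        pivot-term = begin
          - (a · c) * X i₀                      ≡⟨ sym (neg-swap (a · c) (X i₀)) ⟩
          (a · c) * - X i₀                      ≡⟨ *-distribʳ-sum (- X i₀) (λ j → a j * c j) ⟩
          ∑[ j < p ] (a j * c j * - X i₀)       ≡⟨ sum-cong-≗ (λ j → trans (*-assoc (a j) (c j) _)
                                                                    (cong (a j *_) (neg-swap (c j) (X i₀)))) ⟩
          ∑[ j < p ] (a j * ((- c j) * X i₀))   ∎

    reduce-pivot-row : ∀ j → reduce r j ≡ 0#
    reduce-pivot-row j = begin
      r (punchIn i₀ j) + (- c j) * r i₀     ≡⟨ cong (r (punchIn i₀ j) +_) (sym (-‿distribˡ-* (c j) (r i₀))) ⟩
      r (punchIn i₀ j) + - (c j * r i₀)     ≡⟨ cong (λ t → r (punchIn i₀ j) + - t) cⱼ-times-pivot ⟩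
      r (punchIn i₀ j) + - r (punchIn i₀ j) ≡⟨ -‿inverseʳ _ ⟩
      0#                                    ∎
      where
        cⱼ-times-pivot : c j * r i₀ ≡ r (punchIn i₀ j)
        cⱼ-times-pivot = begin
          r (punchIn i₀ j) * r⁻¹ * r i₀         ≡⟨ *-assoc _ _ _ ⟩
          r (punchIn i₀ j) * (r⁻¹ * r i₀)       ≡⟨ cong (r (punchIn i₀ j) *_) (trans (*-comm _ _) r⁻¹-inverse) ⟩
          r (punchIn i₀ j) * 1#                 ≡⟨ trans (*-comm _ _) (*-identityˡ _) ⟩
          r (punchIn i₀ j)                      ∎

    reduceFamily : {A : Set} → (Fin (suc p) → Vect A) → Fin p → Vect A
    reduceFamily u j x = reduce (λ i → u i x) j

    lc-reduceFamily : {A : Set} (a : Fin p → F) (u : Fin (suc p) → Vect A) →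
                      lc a (reduceFamily u) ≈ᵥ lc (extend a) u
    lc-reduceFamily a u x = sym (extend-· a (λ i → u i x))

    reduceFamily-independent : {A : Set} {u : Fin (suc p) → Vect A} →
                               Independent u → Independent (reduceFamily u)
    reduceFamily-independent {u = u} indep a a-dep j = begin
      a j                          ≡⟨ sym (insertAt-punchIn a i₀ _ j) ⟩
      extend a (punchIn i₀ j)      ≡⟨ indep (extend a) (λ x → trans (sym (lc-reduceFamily a u x)) (a-dep x)) _ ⟩
      0#                           ∎

    extend-kernel : ∀ (a : Fin p → F) (rows : List (Fin (suc p) → F)) →
                    Orthogonal a (map reduce rows) → Orthogonal (extend a) (r ∷ rows)
    extend-kernel a rows a⊥rows =
      trans (extend-· a r) (sum-zero (λ j → trans (cong (a j *_) (reduce-pivot-row j)) (zeroʳ _)))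
      ∷ All.map (λ {s} a⊥s → trans (extend-· a s) a⊥s) (All.map⁻ a⊥rows)

  Steinitz : ℕ → Set₁
  Steinitz N = ∀ {A : Set} {p} (u : Fin p → Vect A) (w : Fin N → Vect A) →
               Independent u → (∀ i → Span w (u i)) → p ℕ.≤ N

  -- Gaussian elimination: a zero row is dropped, a row with a pivot
  -- removes one vector and one row.
  RankBound : ℕ → Set₁
  RankBound N = ∀ {A : Set} {p} (rows : List (Fin p → F)) (u : Fin p → Vect A) (w : Fin N → Vect A) →
                Independent u → (∀ a → Orthogonal a rows → Span w (lc a u)) →
                p ℕ.≤ length rows ℕ.+ N

  eliminate : ∀ {N} → Steinitz N → RankBound N
  eliminate-at-pivot : ∀ {N} → Steinitz N →
    ∀ {A : Set} {p} (r : Fin p → F) (i₀ : Fin p) → r i₀ ≢ 0# →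
    (rows : List (Fin p → F)) (u : Fin p → Vect A) (w : Fin N → Vect A) →
    Independent u → (∀ a → Orthogonal a (r ∷ rows) → Span w (lc a u)) →
    p ℕ.≤ length (r ∷ rows) ℕ.+ N

  eliminate steinitzN [] u w indep kernel⊆span =
    steinitzN u w indep (λ i → IsSubspace.resp (span-subspace w) (lc-unit i u) (kernel⊆span (unit i) []))
  eliminate steinitzN (r ∷ rows) u w indep kernel⊆span with zero-or-pivot r
  ... | inj₁ r≡0 =
    ℕ.m≤n⇒m≤1+n (eliminate steinitzN rows u w indep (λ a a⊥rows → kernel⊆span a (a⊥r a ∷ a⊥rows)))
    where
      a⊥r : ∀ a → a · r ≡ 0#
      a⊥r a = sum-zero (λ i → trans (cong (a i *_) (r≡0 i)) (zeroʳ _))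
  ... | inj₂ (i₀ , r≢0) = eliminate-at-pivot steinitzN r i₀ r≢0 rows u w indep kernel⊆span

  eliminate-at-pivot steinitzN {p = suc p} r i₀ r≢0 rows u w indep kernel⊆span =
    s≤s (subst (λ q → p ℕ.≤ q ℕ.+ _) (length-map reduce rows)
          (eliminate steinitzN (map reduce rows) (reduceFamily u) w (reduceFamily-independent {u = u} indep)
            (λ a a⊥rows → IsSubspace.resp (span-subspace w) (λ x → sym (lc-reduceFamily a u x))
                            (kernel⊆span (extend a) (extend-kernel a rows a⊥rows)))))
    where open Pivot r i₀ r≢0

  steinitz₀ : Steinitz 0
  steinitz₀ {p = zero}  u w indep u∈span = z≤n
  steinitz₀ {p = suc p} u w indep u∈span = ⊥-elim (0≢1 (begin
    0#                             ≡⟨ sym (indep (unit Fin.zero) u₀≈0 Fin.zero) ⟩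
    unit {suc p} Fin.zero Fin.zero ≡⟨ unit-diag {suc p} Fin.zero ⟩
    1#                             ∎))
    where
      u₀≈0 : lc (unit Fin.zero) u ≈ᵥ zeroᵥ
      u₀≈0 x = trans (lc-unit Fin.zero u x) (proj₂ (u∈span Fin.zero) x)

  -- If each uᵢ = Σₗ Mᵢₗ wₗ, the columns of M give N rows whose kernel maps to 0.
  steinitz : ∀ N → Steinitz N
  steinitz N {p = p} u w indep u∈span =
    subst (p ℕ.≤_) (trans (ℕ.+-identityʳ _) (length-tabulate columns))
      (eliminate steinitz₀ (tabulate columns) u (λ ()) indep kernel⊆0)
    where
      M : Fin p → Fin N → F
      M i = proj₁ (u∈span i)
      columns : Fin N → Fin p → F
      columns l i = M i l
      kernel⊆0 : ∀ a → Orthogonal a (tabulate columns) → Span (λ ()) (lc a u)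
      kernel⊆0 a a⊥columns = (λ ()) , λ x → begin
        lc a u x                        ≡⟨ lc-congʳ a (λ i → proj₂ (u∈span i)) x ⟩
        lc a (λ i → lc (M i) w) x       ≡⟨ lc-lc a M w x ⟩
        lc (λ l → a · columns l) w x    ≡⟨ lc-zero w (All.tabulate⁻ a⊥columns) x ⟩
        0#                              ∎

  rank-bound : ∀ N → RankBound N
  rank-bound N = eliminate (steinitz N)

  liftedBasis : {n d : ℕ} {C : Subspace (Fin n)} {J : Fin n → Set} →
                HasDim (shortened C J) d → Fin d → Vect (Fin n)
  liftedBasis hJ s = proj₁ (HasDim.basis∈ hJ s)

  supported-in-span : {n d : ℕ} {C : Subspace (Fin n)} {J : Fin n → Set} →
    (∀ i → Dec (J i)) → (hJ : HasDim (shortened C J) d) →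
    ∀ {y} → C y → (∀ i → ¬ J i → y i ≡ 0#) → Span (liftedBasis hJ) y
  supported-in-span {d = d} {J = J} J? hJ {y} y∈C y-off = e , coordinate
    where
      open HasDim hJ
      expansion : ∃[ e ] ((y ∘ proj₁) ≈ᵥ lincomb d e basis)
      expansion = spanning (y ∘ proj₁) (y , y∈C , y-off , λ _ → refl)
      e : Fin d → F
      e = proj₁ expansion
      y≈e : ∀ (k : Sub J) → y (proj₁ k) ≡ lc e basis k
      y≈e k = trans (proj₂ expansion k) (lincomb≗lc e basis k)
      lift-off : ∀ s i → ¬ J i → liftedBasis hJ s i ≡ 0#
      lift-off s = proj₁ (proj₂ (proj₂ (basis∈ s)))
      lift-on : ∀ s (k : Sub J) → liftedBasis hJ s (proj₁ k) ≡ basis s k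
      lift-on s = proj₂ (proj₂ (proj₂ (basis∈ s)))
      coordinate : ∀ i → y i ≡ lc e (liftedBasis hJ) i
      coordinate i with J? i
      ... | yes i∈J = trans (y≈e (i , i∈J)) (sum-cong-≗ (λ s → cong (e s *_) (sym (lift-on s (i , i∈J)))))
      ... | no  i∉J =
        trans (y-off i i∉J) (sym (sum-zero (λ s → trans (cong (e s *_) (lift-off s i i∉J)) (zeroʳ _))))

module Behaviour (𝔽 : FiniteField) {n m : ℕ} {G : Graph m} {ω : Fin n → Fin m}
                 (Γ : Models.GraphicalModel 𝔽 G ω) where
  open FiniteField 𝔽 renaming (Carrier to F)
  open LinearAlgebra 𝔽
  open Models 𝔽 using (module GraphicalModel)
  open GraphicalModel Γ
  open ≡-Reasoning

  combination : ∀ {d} → (Fin d → F) → (Fin d → Config) → Config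
  combination {d} a bs = (λ i → ∑[ k < d ] (a k * symbols (bs k) i))
                       , (λ e t → ∑[ k < d ] (a k * states (bs k) e t))

  local-combination : ∀ {d} (a : Fin d → F) bs v → local (combination a bs) v ≈ᵥ lc a (λ k → local (bs k) v)
  local-combination a bs v (inj₁ _) = refl
  local-combination a bs v (inj₂ _) = refl

  combination-in-behaviour : ∀ {d} (a : Fin d → F) {bs} → (∀ k → InBehavior (bs k)) →
                             InBehavior (combination a bs)
  combination-in-behaviour a {bs} bs∈𝔅 v =
    IsSubspace.resp (Cv-subspace v) (λ y → sym (local-combination a bs v y))
      (lc-closed (Cv-subspace v) a (λ k → local (bs k) v) (λ k → bs∈𝔅 k v))

  module Cut {W : Fin m → Bool} {δ : ℕ} {κ : Fin m → Maybe (Fin δ)} (comps : Components G W δ κ) where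
    open Components comps

    SilentOn : Config → Set
    SilentOn b = ∀ v → W v ≡ true → local b v ≈ᵥ zeroᵥ

    Attached : Fin δ → Fin n → Set
    Attached j i = κ (ω i) ≡ just j

    inComponent? : ∀ j v → Dec (κ v ≡ just j)
    inComponent? j v = Maybe.≡-dec Fin._≟_ (κ v) (just j)

    component-off-cut : ∀ {v j} → κ v ≡ just j → W v ≡ false
    component-off-cut {v} κv with W v in Wv
    ... | false = refl
    ... | true  with () ← trans (sym (inW v Wv)) κv

    unlabelled-in-cut : ∀ {v} → κ v ≡ nothing → W v ≡ true
    unlabelled-in-cut {v} κv with W v in Wv
    ... | true  = refl
    ... | false with () ← trans (sym κv) (proj₂ (notInW v Wv))

    crossing-edge-in-cut : ∀ {e u v j} → Joins G e u v → κ u ≡ just j → κ v ≢ just j → W v ≡ true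
    crossing-edge-in-cut {e} {u} {v} joins κu κv≢ with W v in Wv
    ... | true  = refl
    ... | false = ⊥-elim (κv≢ (trans (sym (reachSame u v (step e (component-off-cut κu) joins (here Wv)))) κu))

    leaving-state-zero : ∀ {b} → SilentOn b → ∀ e t {j} → κ (src e) ≡ just j → κ (tgt e) ≢ just j →
                         states b e t ≡ 0#
    leaving-state-zero silent e t κs κt =
      silent (tgt e) (crossing-edge-in-cut (inj₁ (refl , refl)) κs κt) (inj₂ (e , inj₂ refl , t))

    entering-state-zero : ∀ {b} → SilentOn b → ∀ e t {j} → κ (tgt e) ≡ just j → κ (src e) ≢ just j →
                          states b e t ≡ 0#
    entering-state-zero silent e t κt κs =
      silent (src e) (crossing-edge-in-cut (inj₂ (refl , refl)) κt κs) (inj₂ (e , inj₁ refl , t))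

    mask : Fin δ → Fin m → F → F
    mask j v x with inComponent? j v
    ... | yes _ = x
    ... | no  _ = 0#

    mask-in : ∀ {j v x} → κ v ≡ just j → mask j v x ≡ x
    mask-in {j} {v} κv with inComponent? j v
    ... | yes _   = refl
    ... | no  κv≢ = ⊥-elim (κv≢ κv)

    mask-out : ∀ {j v x} → κ v ≢ just j → mask j v x ≡ 0#
    mask-out {j} {v} κv≢ with inComponent? j v
    ... | yes κv = ⊥-elim (κv≢ κv)
    ... | no  _  = refl

    -- the restriction b_j of b to G_j; an edge belongs to the component of its source
    restrict : Fin δ → Config → Config
    restrict j b = (λ i → mask j (ω i) (symbols b i)) , (λ e t → mask j (src e) (states b e t))

    -- inside G_j the restriction agrees with b (edges entering G_j carry 0),
    -- outside G_j it vanishes (edges leaving G_j carry 0)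
    restrict-inside : ∀ {b j v} → SilentOn b → κ v ≡ just j → local (restrict j b) v ≈ᵥ local b v
    restrict-inside silent κv (inj₁ (i , refl))          = mask-in κv
    restrict-inside silent κv (inj₂ (e , inj₁ refl , t)) = mask-in κv
    restrict-inside {j = j} silent κv (inj₂ (e , inj₂ refl , t)) with inComponent? j (src e)
    ... | yes _  = refl
    ... | no  κs = sym (entering-state-zero silent e t κv κs)

    restrict-outside : ∀ {b j v} → SilentOn b → κ v ≢ just j → local (restrict j b) v ≈ᵥ zeroᵥ
    restrict-outside silent κv (inj₁ (i , refl))          = mask-out κv
    restrict-outside silent κv (inj₂ (e , inj₁ refl , t)) = mask-out κv
    restrict-outside {j = j} silent κv (inj₂ (e , inj₂ refl , t)) with inComponent? j (src e)
    ... | yes κs = leaving-state-zero silent e t κs κv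
    ... | no  _  = refl

    restrict-in-behaviour : ∀ {b} j → InBehavior b → SilentOn b → InBehavior (restrict j b)
    restrict-in-behaviour {b} j b∈𝔅 silent v with inComponent? j v
    ... | yes κv = IsSubspace.resp (Cv-subspace v) (λ y → sym (restrict-inside silent κv y)) (b∈𝔅 v)
    ... | no  κv = IsSubspace.resp (Cv-subspace v) (λ y → sym (restrict-outside silent κv y))
                     (IsSubspace.zero∈ (Cv-subspace v))

    symbols-split : ∀ {b} → SilentOn b → symbols b ≈ᵥ (λ i → ∑[ j < δ ] symbols (restrict j b) i)
    symbols-split {b} silent i = by-label (κ (ω i)) refl
      where
        by-label : ∀ l → κ (ω i) ≡ l → symbols b i ≡ ∑[ j < δ ] symbols (restrict j b) i
        by-label (just j₀) κωi = sym (begin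
          ∑[ j < δ ] symbols (restrict j b) i  ≡⟨ sum-single j₀ _ other-components ⟩
          mask j₀ (ω i) (symbols b i)          ≡⟨ mask-in κωi ⟩
          symbols b i                          ∎)
          where
            other-components : ∀ j → j ≢ j₀ → symbols (restrict j b) i ≡ 0#
            other-components j j≢j₀ = mask-out (λ κ≡j → j≢j₀ (Maybe.just-injective (trans (sym κ≡j) κωi)))
        by-label nothing κωi = begin
          symbols b i                          ≡⟨ silent (ω i) (unlabelled-in-cut κωi) (inj₁ (i , refl)) ⟩
          0#                                   ≡⟨ sym (sum-zero no-component) ⟩
          ∑[ j < δ ] symbols (restrict j b) i  ∎
          where
            no-component : ∀ j → symbols (restrict j b) i ≡ 0#
            no-component j = mask-out (λ κ≡j → case trans (sym κωi) κ≡j of λ ())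

    -- The symbol sequence of a silent behaviour is a sum of codewords
    -- supported on the components, hence lies in the span of the lifted
    -- bases of the shortened codes C_{J₁}, …, C_{J_δ}.
    module _ {C : Subspace (Fin n)} (realizes : Realizes C)
             {dimJ : Fin δ → ℕ} (hJ : ∀ j → HasDim (shortened C (Attached j)) (dimJ j)) where

      componentBasis : List (Vect (Fin n))
      componentBasis = concatMap (λ j → tabulate (liftedBasis (hJ j))) (allFin δ)

      length-componentBasis : length componentBasis ≡ sumFin δ dimJ
      length-componentBasis =
        trans (length-concatMap _ (allFin δ))
              (cong sumℕ (map-cong (λ j → length-tabulate (liftedBasis (hJ j))) (allFin δ)))

      lifted∈componentBasis : ∀ j s → liftedBasis (hJ j) s ∈ componentBasis
      lifted∈componentBasis j s = ∈-concat⁺′ (∈-tabulate⁺ s) (∈-map⁺ _ (∈-allFin j))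

      restrict-in-span : ∀ {b} j → InBehavior b → SilentOn b → Span (liftedBasis (hJ j)) (symbols (restrict j b))
      restrict-in-span {b} j b∈𝔅 silent =
        supported-in-span (λ i → inComponent? j (ω i)) (hJ j)
          (proj₂ (realizes (symbols (restrict j b))) (restrict j b)
                 (restrict-in-behaviour j b∈𝔅 silent) (λ _ → refl))
          (λ i i∉Jj → mask-out i∉Jj)

      cut-decomposition : ∀ {b} → InBehavior b → SilentOn b → Span (List.lookup componentBasis) (symbols b)
      cut-decomposition b∈𝔅 silent =
        IsSubspace.resp (span-subspace _) (λ i → sym (symbols-split silent i))
          (sum-closed (span-subspace _) _ (λ j →
            span-mono (λ s → member-in-span (lifted∈componentBasis j s)) (restrict-in-span j b∈𝔅 silent)))

      module _ {dimC : ℕ} (hC : HasDim C dimC)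
               {dimCv : Fin m → ℕ} (hCv : ∀ v → HasDim (Cv v) (dimCv v)) where

        lifting : ∀ k → ∃[ b ] (InBehavior b × symbols b ≈ᵥ HasDim.basis hC k)
        lifting k = proj₁ (realizes (HasDim.basis hC k)) (HasDim.basis∈ hC k)

        lift : Fin dimC → Config
        lift k = proj₁ (lifting k)

        lift∈𝔅 : ∀ k → InBehavior (lift k)
        lift∈𝔅 k = proj₁ (proj₂ (lifting k))

        symbols-lift : ∀ k → symbols (lift k) ≈ᵥ HasDim.basis hC k
        symbols-lift k = proj₂ (proj₂ (lifting k))

        coordinates : ∀ v → Fin (dimCv v) → Fin dimC → F
        coordinates v t k = proj₁ (HasDim.spanning (hCv v) (local (lift k) v) (lift∈𝔅 k v)) t

        local-lift : ∀ k v → local (lift k) v ≈ᵥ lc (λ t → coordinates v t k) (HasDim.basis (hCv v))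
        local-lift k v y = trans (proj₂ (HasDim.spanning (hCv v) (local (lift k) v) (lift∈𝔅 k v)) y)
                                 (lincomb≗lc _ (HasDim.basis (hCv v)) y)

        cutRows : List (Fin dimC → F)
        cutRows = concatMap (λ v → if W v then tabulate (coordinates v) else []) (allFin m)

        length-cutRows : length cutRows ≡ sumOver W dimCv
        length-cutRows = trans (length-concatMap _ (allFin m)) (cong sumℕ (map-cong rowCount (allFin m)))
          where
            rowCount : ∀ v → length (if W v then tabulate (coordinates v) else []) ≡ (if W v then dimCv v else 0)
            rowCount v = trans (if-float length (W v)) (cong (if W v then_else 0) (length-tabulate (coordinates v)))

        cutRow∈ : ∀ {v} → W v ≡ true → ∀ t → coordinates v t ∈ cutRows
        cutRow∈ {v} Wv t = ∈-concat⁺′ row∈block (∈-map⁺ _ (∈-allFin v))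
          where
            row∈block : coordinates v t ∈ (if W v then tabulate (coordinates v) else [])
            row∈block rewrite Wv = ∈-tabulate⁺ t

        kernel-silent : ∀ a → Orthogonal a cutRows → SilentOn (combination a lift)
        kernel-silent a a⊥rows v Wv y = begin
          local (combination a lift) v y
            ≡⟨ local-combination a lift v y ⟩
          lc a (λ k → local (lift k) v) y
            ≡⟨ lc-congʳ a (λ k → local-lift k v) y ⟩
          lc a (λ k → lc (λ t → coordinates v t k) (HasDim.basis (hCv v))) y
            ≡⟨ lc-lc a (λ k t → coordinates v t k) (HasDim.basis (hCv v)) y ⟩
          lc (λ t → a · coordinates v t) (HasDim.basis (hCv v)) y
            ≡⟨ lc-zero (HasDim.basis (hCv v)) (λ t → All.lookup a⊥rows (cutRow∈ Wv t)) y ⟩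
          0# ∎

        dimension-bound : dimC ℕ.≤ sumOver W dimCv ℕ.+ sumFin δ dimJ
        dimension-bound =
          subst₂ (λ q N → dimC ℕ.≤ q ℕ.+ N) length-cutRows length-componentBasis
            (rank-bound _ cutRows (HasDim.basis hC) (List.lookup componentBasis) basis-independent kernel⊆span)
          where
            basis-independent : Independent (HasDim.basis hC)
            basis-independent a a-dep =
              HasDim.independent hC a (λ x → trans (lincomb≗lc a (HasDim.basis hC) x) (a-dep x))
            kernel⊆span : ∀ a → Orthogonal a cutRows → Span (List.lookup componentBasis) (lc a (HasDim.basis hC))
            kernel⊆span a a⊥rows =
              IsSubspace.resp (span-subspace _) (lc-congʳ a {v = HasDim.basis hC} symbols-lift)
                (cut-decomposition (combination-in-behaviour a lift∈𝔅) (kernel-silent a a⊥rows))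

open import Data.Integer using (+_; _-_; _≤_; _⊖_)
import Data.Integer.Properties as ℤ

difference-bound : ∀ {d q N} → d ℕ.≤ q ℕ.+ N → + d - + N ≤ + q
difference-bound {d} {q} {N} d≤q+N = begin
  + d - + N        ≡⟨ ℤ.[+m]-[+n]≡m⊖n d N ⟩
  d ⊖ N            ≤⟨ ℤ.⊖-monoˡ-≤ N d≤q+N ⟩
  (q ℕ.+ N) ⊖ N    ≡⟨ ℤ.≤-⊖ (ℕ.m≤n+m N q) ⟩
  + (q ℕ.+ N ∸ N)  ≡⟨ cong +_ (ℕ.m+n∸n≡m q N) ⟩
  + q              ∎
  where open ℤ.≤-Reasoning

corollary4p4 :
    (𝔽 : FiniteField) → let open Models 𝔽 in
    {n m : ℕ}
    (C : Subspace (Fin n)) → IsSubspace C →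
    (G : Graph m) → Connected G → (ω : Fin n → Fin m) →
    (W : Fin m → Bool) → VertexCut G W →
    (δ : ℕ) (κ : Fin m → Maybe (Fin δ)) → Components G W δ κ →
    (Γ : GraphicalModel G ω) → IsRealization C Γ →
    (dimC : ℕ) → HasDim C dimC →
    (dimJ : Fin δ → ℕ) → (∀ j → HasDim (shortened C (λ i → κ (ω i) ≡ just j)) (dimJ j)) →
    (dimCv : Fin m → ℕ) → (∀ v → HasDim (GraphicalModel.Cv Γ v) (dimCv v)) →
    (+ dimC) - (+ sumFin δ dimJ) ≤ + sumOver W dimCv
corollary4p4 𝔽 C _ G _ ω W _ δ κ comps Γ (_ , realizes) dimC hC dimJ hJ dimCv hCv =
  difference-bound (Behaviour.Cut.dimension-bound 𝔽 Γ comps realizes hJ hC hCv)
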